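{- Let $\xi\in\mathbb{F}_q((T^{ -1}))\setminus\mathbb{F}_q(T)$ with $|\xi|\le 1$, with convergents $P_n/Q_n$. Let $k\in\mathbb{N}$, $a\in\mathbb{F}_q[T]$, and let $N=\begin{pmatrix} t & t'\\ s & s'\end{pmatrix}$ be any matrix in $\mathrm{SL}_2(\mathbb{F}_q[T])$. Then $\gamma = N\,U(a)\,M_k$ satisfies \[ \big|\big(aQ_{k-1} + (-1)^{k-1}Q_k\big)s\big| - |s'Q_{k-1}| \;\leq\; |\gamma| \;\leq\; |N|\cdot\max\{ |Q_k|, |aQ_{k-1}| \}. \]
   Context: $\mathbb{F}_q((T^{ -1}))$ is the field of formal Laurent series in $T^{ -1}$ over the finite field $\mathbb{F}_q$ with absolute value $|x|=q^{\deg x}$, $|0|=0$; for a matrix, $|\cdot|$ is the maximum of the absolute values of its entries. Convergents: $\xi=[A_0;A_1,\dots]$ is the continued fraction expansion ($A_i\in\mathbb{F}_q[T]$, $\deg A_i>0$ for $i\ge1$), $P_{ -2}=0,P_{ -1}=1,Q_{ -2}=1,Q_{ -1}=0$, $P_n=A_nP_{n-1}+P_{n-2}$, $Q_n=A_nQ_{n-1}+Q_{n-2}$ ($n\ge0$). For $a\in\mathbb{F}_q[T]$, $U(a)=\begin{pmatrix}1&a\\0&1\end{pmatrix}$, and $M_k=\begin{pmatrix} Q_k & -P_k\\ (-1)^{k-1}Q_{k-1} & (-1)^kP_{k-1}\end{pmatrix}\in\mathrm{SL}_2(\mathbb{F}_q[T])$. -}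

module Defs where

open import Data.Nat using (ℕ; zero; suc; _⊔_; _≤_; _<_)
open import Data.Fin using (Fin)
import Data.Fin as F
open import Data.List using (List; []; _∷_; map)
open import Data.Product using (∃; _×_)
open import Relation.Binary.PropositionalEquality using (_≡_; _≢_)
open import Relation.Nullary using (yes; no)
open import Algebra.Structures using (IsCommutativeRing)
import Data.Nat as N

record FiniteField (q : ℕ) : Set where
  field
    _+_ _*_ : Fin q → Fin q → Fin q
    -_      : Fin q → Fin q
    0# 1#   : Fin q
    isCommutativeRing : IsCommutativeRing _≡_ _+_ _*_ -_ 0# 1#
    0≢1     : 0# ≢ 1#
    inverse : ∀ x → x ≢ 0# → ∃ λ y → x * y ≡ 1#

-- Polynomials in F_q[T]: coefficient lists, lowest degree first.
-- Trailing zeros are allowed; equality is coefficientwise (_≈ₚ_).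

module Poly {q : ℕ} (𝔽 : FiniteField q) where
  open FiniteField 𝔽

  Pol : Set
  Pol = List (Fin q)

  coeff : Pol → ℕ → Fin q
  coeff []       _       = 0#
  coeff (c ∷ p)  zero    = c
  coeff (c ∷ p)  (suc i) = coeff p i

  infix 4 _≈ₚ_
  _≈ₚ_ : Pol → Pol → Set
  p ≈ₚ r = ∀ i → coeff p i ≡ coeff r i

  0ₚ : Pol
  0ₚ = []

  1ₚ : Pol
  1ₚ = 1# ∷ []

  infixl 6 _+ₚ_ _-ₚ_
  infixl 7 _*ₚ_

  _+ₚ_ : Pol → Pol → Pol
  []      +ₚ r       = r
  (c ∷ p) +ₚ []      = c ∷ p
  (c ∷ p) +ₚ (d ∷ r) = (c + d) ∷ (p +ₚ r)

  -ₚ_ : Pol → Pol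
  -ₚ p = map -_ p

  _-ₚ_ : Pol → Pol → Pol
  p -ₚ r = p +ₚ (-ₚ r)

  scale : Fin q → Pol → Pol
  scale c p = map (c *_) p

  _*ₚ_ : Pol → Pol → Pol
  []      *ₚ r = []
  (c ∷ p) *ₚ r = scale c r +ₚ (0# ∷ (p *ₚ r))

  sgn : ℕ → Pol → Pol
  sgn zero          p = p
  sgn (suc zero)    p = -ₚ p
  sgn (suc (suc n)) p = sgn n p

  -- absolute value |p| = q ^ deg p, |0| = 0 (as a natural number)
  ∣_∣ : Pol → ℕ
  ∣ [] ∣ = 0
  ∣ c ∷ p ∣ with ∣ p ∣
  ... | suc m = q N.* suc m
  ... | zero with c F.≟ 0#
  ...   | yes _ = 0
  ...   | no  _ = 1

  record Mat2 : Set where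
    constructor mat
    field
      m11 m12 m21 m22 : Pol

  open Mat2 public

  infixl 7 _·_
  _·_ : Mat2 → Mat2 → Mat2
  mat a b c d · mat a' b' c' d' =
    mat (a *ₚ a' +ₚ b *ₚ c') (a *ₚ b' +ₚ b *ₚ d')
        (c *ₚ a' +ₚ d *ₚ c') (c *ₚ b' +ₚ d *ₚ d')

  det : Mat2 → Pol
  det (mat a b c d) = a *ₚ d -ₚ b *ₚ c

  InSL2 : Mat2 → Set
  InSL2 M = det M ≈ₚ 1ₚ

  ∥_∥ : Mat2 → ℕ
  ∥ mat a b c d ∥ = (∣ a ∣ ⊔ ∣ b ∣) ⊔ (∣ c ∣ ⊔ ∣ d ∣)

  U : Pol → Mat2
  U a = mat 1ₚ a 0ₚ 1ₚ

  -- Continued fractions: partial quotients A 0, A 1, ... and convergents.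
  -- Shifted indexing: Ps n = P_{n-2}, Qs n = Q_{n-2}.

  Ps Qs : (ℕ → Pol) → ℕ → Pol
  Ps A zero          = 0ₚ
  Ps A (suc zero)    = 1ₚ
  Ps A (suc (suc n)) = A n *ₚ Ps A (suc n) +ₚ Ps A n
  Qs A zero          = 1ₚ
  Qs A (suc zero)    = 0ₚ
  Qs A (suc (suc n)) = A n *ₚ Qs A (suc n) +ₚ Qs A n

  -- P_n, Q_n for n ≥ 0, and P_{n-1}, Q_{n-1} for n ≥ 0 (P_{-1}=1, Q_{-1}=0)
  P Q P₋₁ Q₋₁ : (ℕ → Pol) → ℕ → Pol
  P   A n = Ps A (suc (suc n))
  Q   A n = Qs A (suc (suc n))
  P₋₁ A n = Ps A (suc n)
  Q₋₁ A n = Qs A (suc n)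

  -- A is a valid continued fraction expansion of some irrational ξ with |ξ| ≤ 1:
  -- |A₀| ≤ 1 (i.e. deg A₀ ≤ 0) and deg A_i > 0 for i ≥ 1.
  IsCFExpansion : (ℕ → Pol) → Set
  IsCFExpansion A = (∣ A 0 ∣ ≤ 1) × (∀ i → 1 < ∣ A (suc i) ∣)

  M : (ℕ → Pol) → ℕ → Mat2
  M A k = mat (Q A k) (-ₚ P A k) (sgn (suc k) (Q₋₁ A k)) (sgn k (P₋₁ A k))

{-# OPTIONS --safe #-}
module Submission where

-- The absolute value is multiplicative and ultrametric on F_q[T].  Since |A_{n+1}| > 1, the
-- recurrence for the convergents gives |Q_{n-1}| < |Q_n| and |P_n|, |P_{n-1}| ≤ |Q_n|, so every
-- entry of U(a) M_k has absolute value at most max(|Q_k|, |a Q_{k-1}|), and the upper bound is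
-- |N (U(a) M_k)| ≤ |N| |U(a) M_k|.  For the lower bound,
-- (-1)^(k-1) γ₂₁ = (a Q_{k-1} + (-1)^(k-1) Q_k) s + s' Q_{k-1}, and |x| - |y| ≤ |x + y|.

open import Defs
open import Data.Nat
  using (ℕ; zero; suc; _+_; _*_; _^_; _⊔_; _≤_; _<_; _∸_; z≤n; s≤s; NonZero; >-nonZero)
import Data.Nat.Properties as ℕ
open import Data.Fin as Fin using (Fin)
open import Data.Fin.Properties using (nonZeroIndex)
open import Data.List using ([]; _∷_)
open import Data.Product using (_×_; _,_; ∃₂)
open import Data.Sum using (_⊎_; inj₁; inj₂)
open import Data.Empty using (⊥-elim)
open import Level using (0ℓ)
open import Relation.Nullary using (yes; no)
open import Relation.Binary.Bundles using (Setoid)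
open import Relation.Binary.Structures using (IsEquivalence)
open import Relation.Binary.PropositionalEquality
open import Algebra.Bundles using (CommutativeRing)
import Algebra.Consequences.Setoid as Consequences
import Relation.Binary.Reasoning.Setoid
import Algebra.Properties.AbelianGroup as AbelianGroupProperties
import Algebra.Properties.Ring as RingProperties
import Algebra.Solver.Ring.NaturalCoefficients.Default as NaturalCoefficientSolver

module _ {q : ℕ} (𝔽 : FiniteField q) where
  open FiniteField 𝔽 renaming (_+_ to infixl 6 _⊕_; _*_ to infixl 7 _⊗_; -_ to infix 8 ⊖_)
  open Poly 𝔽

  private
    𝔽-ring : CommutativeRing 0ℓ 0ℓ
    𝔽-ring = record { isCommutativeRing = isCommutativeRing }

    module F = CommutativeRing 𝔽-ring
    module F-Group = AbelianGroupProperties F.+-abelianGroup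

  open NaturalCoefficientSolver F.commutativeSemiring using (solve; _:=_; _:+_; _:*_)

  -- F_q[T] as a commutative ring

  coeff-+ₚ : ∀ p r i → coeff (p +ₚ r) i ≡ coeff p i ⊕ coeff r i
  coeff-+ₚ []      r       i       = sym (F.+-identityˡ _)
  coeff-+ₚ (c ∷ p) []      i       = sym (F.+-identityʳ _)
  coeff-+ₚ (c ∷ p) (d ∷ r) zero    = refl
  coeff-+ₚ (c ∷ p) (d ∷ r) (suc i) = coeff-+ₚ p r i

  coeff--ₚ : ∀ p i → coeff (-ₚ p) i ≡ ⊖ coeff p i
  coeff--ₚ []      i       = sym F-Group.ε⁻¹≈ε
  coeff--ₚ (c ∷ p) zero    = refl
  coeff--ₚ (c ∷ p) (suc i) = coeff--ₚ p i

  coeff-scale : ∀ c p i → coeff (scale c p) i ≡ c ⊗ coeff p i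
  coeff-scale c []      i       = sym (F.zeroʳ c)
  coeff-scale c (d ∷ p) zero    = refl
  coeff-scale c (d ∷ p) (suc i) = coeff-scale c p i

  coeff-∷-*ₚ : ∀ c p r i → coeff ((c ∷ p) *ₚ r) i ≡ c ⊗ coeff r i ⊕ coeff (0# ∷ p *ₚ r) i
  coeff-∷-*ₚ c p r i = trans (coeff-+ₚ (scale c r) (0# ∷ p *ₚ r) i)
                             (cong (_⊕ coeff (0# ∷ p *ₚ r) i) (coeff-scale c r i))

  -- _≈ₚ_ unfolds to a Π-type, from which Agda cannot recover the two polynomials;
  -- wrapping it in a record makes them inferable.
  infix 4 _≋_
  record _≋_ (p r : Pol) : Set where
    constructor coeffwise
    field coeff≡ : p ≈ₚ r
  open _≋_

  ≋-isEquivalence : IsEquivalence _≋_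
  ≋-isEquivalence = record
    { refl  = coeffwise λ _ → refl
    ; sym   = λ (coeffwise p≈r) → coeffwise λ i → sym (p≈r i)
    ; trans = λ (coeffwise p≈r) (coeffwise r≈s) → coeffwise λ i → trans (p≈r i) (r≈s i)
    }

  open IsEquivalence ≋-isEquivalence using ()
    renaming (refl to ≋-refl; sym to ≋-sym; trans to ≋-trans)

  ≋-setoid : Setoid 0ℓ 0ℓ
  ≋-setoid = record { isEquivalence = ≋-isEquivalence }

  module ≋-Reasoning = Relation.Binary.Reasoning.Setoid ≋-setoid

  ∷-cong : ∀ {c d p r} → c ≡ d → p ≋ r → c ∷ p ≋ d ∷ r
  ∷-cong c≡d (coeffwise p≈r) = coeffwise λ { zero → c≡d ; (suc i) → p≈r i }

  0∷-cong : ∀ {p r} → p ≋ r → 0# ∷ p ≋ 0# ∷ r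
  0∷-cong = ∷-cong refl

  0∷-≋0 : ∀ {p} → p ≋ [] → 0# ∷ p ≋ []
  0∷-≋0 (coeffwise p≈0) = coeffwise λ { zero → refl ; (suc i) → p≈0 i }

  0∷-+ₚ : ∀ p r → 0# ∷ (p +ₚ r) ≋ (0# ∷ p) +ₚ (0# ∷ r)
  0∷-+ₚ p r = ∷-cong (sym (F.+-identityˡ 0#)) (coeffwise λ _ → refl)

  +ₚ-cong : ∀ {p p' r r'} → p ≋ p' → r ≋ r' → p +ₚ r ≋ p' +ₚ r'
  +ₚ-cong {p} {p'} {r} {r'} (coeffwise p≈p') (coeffwise r≈r') = coeffwise λ i → begin
    coeff (p +ₚ r) i         ≡⟨ coeff-+ₚ p r i ⟩
    coeff p i ⊕ coeff r i    ≡⟨ cong₂ _⊕_ (p≈p' i) (r≈r' i) ⟩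
    coeff p' i ⊕ coeff r' i  ≡⟨ coeff-+ₚ p' r' i ⟨
    coeff (p' +ₚ r') i       ∎
    where open ≡-Reasoning

  -ₚ‿cong : ∀ {p p'} → p ≋ p' → -ₚ p ≋ -ₚ p'
  -ₚ‿cong {p} {p'} (coeffwise p≈p') = coeffwise λ i →
    trans (coeff--ₚ p i) (trans (cong ⊖_ (p≈p' i)) (sym (coeff--ₚ p' i)))

  scale-cong : ∀ c {p p'} → p ≋ p' → scale c p ≋ scale c p'
  scale-cong c {p} {p'} (coeffwise p≈p') = coeffwise λ i →
    trans (coeff-scale c p i) (trans (cong (c ⊗_) (p≈p' i)) (sym (coeff-scale c p' i)))

  +ₚ-identityʳ : ∀ p → p +ₚ [] ≋ p
  +ₚ-identityʳ []      = coeffwise λ _ → refl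
  +ₚ-identityʳ (c ∷ p) = coeffwise λ _ → refl

  +ₚ-assoc : ∀ p r s → (p +ₚ r) +ₚ s ≋ p +ₚ (r +ₚ s)
  +ₚ-assoc p r s = coeffwise λ i →
    begin
      coeff ((p +ₚ r) +ₚ s) i                 ≡⟨ coeff-+ₚ (p +ₚ r) s i ⟩
      coeff (p +ₚ r) i ⊕ coeff s i            ≡⟨ cong (_⊕ coeff s i) (coeff-+ₚ p r i) ⟩
      coeff p i ⊕ coeff r i ⊕ coeff s i       ≡⟨ F.+-assoc (coeff p i) _ _ ⟩
      coeff p i ⊕ (coeff r i ⊕ coeff s i)     ≡⟨ cong (coeff p i ⊕_) (coeff-+ₚ r s i) ⟨
      coeff p i ⊕ coeff (r +ₚ s) i            ≡⟨ coeff-+ₚ p (r +ₚ s) i ⟨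
      coeff (p +ₚ (r +ₚ s)) i                 ∎
    where open ≡-Reasoning

  +ₚ-comm : ∀ p r → p +ₚ r ≋ r +ₚ p
  +ₚ-comm p r = coeffwise λ i →
    trans (coeff-+ₚ p r i) (trans (F.+-comm (coeff p i) _) (sym (coeff-+ₚ r p i)))

  -ₚ‿inverseʳ : ∀ p → p +ₚ -ₚ p ≋ []
  -ₚ‿inverseʳ p = coeffwise λ i →
    trans (coeff-+ₚ p (-ₚ p) i) (trans (cong (coeff p i ⊕_) (coeff--ₚ p i)) (F.-‿inverseʳ _))

  0∷-*ₚ : ∀ p r → (0# ∷ p) *ₚ r ≋ 0# ∷ p *ₚ r
  0∷-*ₚ p r = coeffwise λ i →
    trans (coeff-∷-*ₚ 0# p r i)
          (trans (cong (_⊕ coeff (0# ∷ p *ₚ r) i) (F.zeroˡ (coeff r i))) (F.+-identityˡ _))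

  *ₚ-zeroʳ : ∀ p → p *ₚ [] ≋ []
  *ₚ-zeroʳ []      = coeffwise λ _ → refl
  *ₚ-zeroʳ (c ∷ p) = 0∷-≋0 (*ₚ-zeroʳ p)

  p≋0⇒p*r≋0 : ∀ p r → p ≋ [] → p *ₚ r ≋ []
  p≋0⇒p*r≋0 []      r _                = coeffwise λ _ → refl
  p≋0⇒p*r≋0 (c ∷ p) r (coeffwise p≈0) = coeffwise λ i →
    begin
      coeff ((c ∷ p) *ₚ r) i                ≡⟨ coeff-∷-*ₚ c p r i ⟩
      c ⊗ coeff r i ⊕ coeff (0# ∷ p *ₚ r) i
        ≡⟨ cong₂ _⊕_ (cong (_⊗ coeff r i) (p≈0 zero)) (coeff≡ tail≋0 i) ⟩
      0# ⊗ coeff r i ⊕ 0#                   ≡⟨ cong (_⊕ 0#) (F.zeroˡ _) ⟩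
      0# ⊕ 0#                               ≡⟨ F.+-identityˡ 0# ⟩
      0#                                    ∎
    where
    open ≡-Reasoning
    tail≋0 : 0# ∷ p *ₚ r ≋ []
    tail≋0 = 0∷-≋0 (p≋0⇒p*r≋0 p r (coeffwise λ j → p≈0 (suc j)))

  *ₚ-congˡ : ∀ p {r r'} → r ≋ r' → p *ₚ r ≋ p *ₚ r'
  *ₚ-congˡ []      r≋r' = coeffwise λ _ → refl
  *ₚ-congˡ (c ∷ p) r≋r' = +ₚ-cong (scale-cong c r≋r') (0∷-cong (*ₚ-congˡ p r≋r'))

  *ₚ-∷ʳ : ∀ p d r → p *ₚ (d ∷ r) ≋ scale d p +ₚ (0# ∷ p *ₚ r)
  *ₚ-∷ʳ []      d r = coeffwise λ { zero → refl ; (suc i) → refl }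
  *ₚ-∷ʳ (c ∷ p) d r = coeffwise λ
    { zero    → cong (_⊕ 0#) (F.*-comm c d)
    ; (suc i) →
      let x = coeff (scale c r) i
          y = coeff (scale d p) i
          z = coeff (0# ∷ p *ₚ r) i
      in begin
        coeff (scale c r +ₚ p *ₚ (d ∷ r)) i             ≡⟨ coeff-+ₚ (scale c r) _ i ⟩
        x ⊕ coeff (p *ₚ (d ∷ r)) i                      ≡⟨ cong (x ⊕_) (coeff≡ (*ₚ-∷ʳ p d r) i) ⟩
        x ⊕ coeff (scale d p +ₚ (0# ∷ p *ₚ r)) i        ≡⟨ cong (x ⊕_) (coeff-+ₚ (scale d p) _ i) ⟩
        x ⊕ (y ⊕ z)
          ≡⟨ solve 3 (λ x y z → x :+ (y :+ z) := y :+ (x :+ z)) refl x y z ⟩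
        y ⊕ (x ⊕ z)                                      ≡⟨ cong (y ⊕_) (coeff-+ₚ (scale c r) _ i) ⟨
        y ⊕ coeff (scale c r +ₚ (0# ∷ p *ₚ r)) i        ≡⟨ coeff-+ₚ (scale d p) _ i ⟨
        coeff (scale d p +ₚ (scale c r +ₚ (0# ∷ p *ₚ r))) i ∎
    }
    where open ≡-Reasoning

  *ₚ-comm : ∀ p r → p *ₚ r ≋ r *ₚ p
  *ₚ-comm []      r = ≋-sym (*ₚ-zeroʳ r)
  *ₚ-comm (c ∷ p) r = begin
    scale c r +ₚ (0# ∷ p *ₚ r)  ≈⟨ +ₚ-cong ≋-refl (0∷-cong (*ₚ-comm p r)) ⟩
    scale c r +ₚ (0# ∷ r *ₚ p)  ≈⟨ *ₚ-∷ʳ r c p ⟨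
    r *ₚ (c ∷ p)                ∎
    where open ≋-Reasoning

  *ₚ-cong : ∀ {p p' r r'} → p ≋ p' → r ≋ r' → p *ₚ r ≋ p' *ₚ r'
  *ₚ-cong {p} {p'} {r} {r'} p≋p' r≋r' = begin
    p *ₚ r    ≈⟨ *ₚ-congˡ p r≋r' ⟩
    p *ₚ r'   ≈⟨ *ₚ-comm p r' ⟩
    r' *ₚ p   ≈⟨ *ₚ-congˡ r' p≋p' ⟩
    r' *ₚ p'  ≈⟨ *ₚ-comm r' p' ⟩
    p' *ₚ r'  ∎
    where open ≋-Reasoning

  *ₚ-distribʳ-+ₚ : ∀ s p r → (p +ₚ r) *ₚ s ≋ p *ₚ s +ₚ r *ₚ s
  *ₚ-distribʳ-+ₚ s []      r       = coeffwise λ _ → refl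
  *ₚ-distribʳ-+ₚ s (c ∷ p) []      = ≋-sym (+ₚ-identityʳ ((c ∷ p) *ₚ s))
  *ₚ-distribʳ-+ₚ s (c ∷ p) (d ∷ r) = coeffwise λ i →
    let x = coeff s i
        u = coeff (0# ∷ p *ₚ s) i
        v = coeff (0# ∷ r *ₚ s) i
    in begin
      coeff (((c ⊕ d) ∷ (p +ₚ r)) *ₚ s) i
        ≡⟨ coeff-∷-*ₚ (c ⊕ d) (p +ₚ r) s i ⟩
      (c ⊕ d) ⊗ x ⊕ coeff (0# ∷ (p +ₚ r) *ₚ s) i
        ≡⟨ cong ((c ⊕ d) ⊗ x ⊕_) (trans (coeff≡ (0∷-cong (*ₚ-distribʳ-+ₚ s p r)) i)
                                 (trans (coeff≡ (0∷-+ₚ (p *ₚ s) (r *ₚ s)) i)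
                                        (coeff-+ₚ (0# ∷ p *ₚ s) (0# ∷ r *ₚ s) i))) ⟩
      (c ⊕ d) ⊗ x ⊕ (u ⊕ v)
        ≡⟨ solve 5 (λ c d x u v → (c :+ d) :* x :+ (u :+ v) := (c :* x :+ u) :+ (d :* x :+ v))
                 refl c d x u v ⟩
      (c ⊗ x ⊕ u) ⊕ (d ⊗ x ⊕ v)
        ≡⟨ cong₂ _⊕_ (coeff-∷-*ₚ c p s i) (coeff-∷-*ₚ d r s i) ⟨
      coeff ((c ∷ p) *ₚ s) i ⊕ coeff ((d ∷ r) *ₚ s) i
        ≡⟨ coeff-+ₚ ((c ∷ p) *ₚ s) _ i ⟨
      coeff ((c ∷ p) *ₚ s +ₚ (d ∷ r) *ₚ s) i ∎
    where open ≡-Reasoning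

  scale-*ₚ : ∀ c r s → scale c r *ₚ s ≋ scale c (r *ₚ s)
  scale-*ₚ c []      s = coeffwise λ _ → refl
  scale-*ₚ c (d ∷ r) s = coeffwise λ i →
    let x = coeff s i
        u = coeff (0# ∷ r *ₚ s) i
    in begin
      coeff ((c ⊗ d ∷ scale c r) *ₚ s) i
        ≡⟨ coeff-∷-*ₚ (c ⊗ d) (scale c r) s i ⟩
      c ⊗ d ⊗ x ⊕ coeff (0# ∷ scale c r *ₚ s) i
        ≡⟨ cong (c ⊗ d ⊗ x ⊕_) (trans (coeff≡ (∷-cong (sym (F.zeroʳ c)) (scale-*ₚ c r s)) i)
                                       (coeff-scale c (0# ∷ r *ₚ s) i)) ⟩
      c ⊗ d ⊗ x ⊕ c ⊗ u
        ≡⟨ solve 4 (λ c d x u → c :* d :* x :+ c :* u := c :* (d :* x :+ u)) refl c d x u ⟩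
      c ⊗ (d ⊗ x ⊕ u)
        ≡⟨ cong (c ⊗_) (coeff-∷-*ₚ d r s i) ⟨
      c ⊗ coeff ((d ∷ r) *ₚ s) i
        ≡⟨ coeff-scale c ((d ∷ r) *ₚ s) i ⟨
      coeff (scale c ((d ∷ r) *ₚ s)) i ∎
    where open ≡-Reasoning

  *ₚ-assoc : ∀ p r s → (p *ₚ r) *ₚ s ≋ p *ₚ (r *ₚ s)
  *ₚ-assoc []      r s = coeffwise λ _ → refl
  *ₚ-assoc (c ∷ p) r s = begin
    (scale c r +ₚ (0# ∷ p *ₚ r)) *ₚ s        ≈⟨ *ₚ-distribʳ-+ₚ s (scale c r) (0# ∷ p *ₚ r) ⟩
    scale c r *ₚ s +ₚ (0# ∷ p *ₚ r) *ₚ s      ≈⟨ +ₚ-cong (scale-*ₚ c r s) (0∷-*ₚ (p *ₚ r) s) ⟩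
    scale c (r *ₚ s) +ₚ (0# ∷ (p *ₚ r) *ₚ s)  ≈⟨ +ₚ-cong ≋-refl (0∷-cong (*ₚ-assoc p r s)) ⟩
    scale c (r *ₚ s) +ₚ (0# ∷ p *ₚ (r *ₚ s))  ∎
    where open ≋-Reasoning

  *ₚ-identityˡ : ∀ p → 1ₚ *ₚ p ≋ p
  *ₚ-identityˡ p = coeffwise λ i → begin
    coeff (1ₚ *ₚ p) i                     ≡⟨ coeff-∷-*ₚ 1# [] p i ⟩
    1# ⊗ coeff p i ⊕ coeff (0# ∷ []) i    ≡⟨ cong (1# ⊗ coeff p i ⊕_) (coeff≡ (0∷-≋0 ≋-refl) i) ⟩
    1# ⊗ coeff p i ⊕ 0#                   ≡⟨ F.+-identityʳ _ ⟩
    1# ⊗ coeff p i                        ≡⟨ F.*-identityˡ _ ⟩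
    coeff p i                             ∎
    where open ≡-Reasoning

  ℙ : CommutativeRing 0ℓ 0ℓ
  ℙ = record
    { Carrier = Pol ; _≈_ = _≋_ ; _+_ = _+ₚ_ ; _*_ = _*ₚ_ ; -_ = -ₚ_ ; 0# = [] ; 1# = 1ₚ
    ; isCommutativeRing = record
      { isRing = record
        { +-isAbelianGroup = record
          { isGroup = record
            { isMonoid = record
              { isSemigroup = record
                { isMagma = record { isEquivalence = ≋-isEquivalence ; ∙-cong = +ₚ-cong }
                ; assoc = +ₚ-assoc }
              ; identity = comm∧idʳ⇒id +ₚ-comm +ₚ-identityʳ }
            ; inverse = comm∧invʳ⇒inv +ₚ-comm -ₚ‿inverseʳ
            ; ⁻¹-cong = -ₚ‿cong }
          ; comm = +ₚ-comm }
        ; *-cong = *ₚ-cong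
        ; *-assoc = *ₚ-assoc
        ; *-identity = comm∧idˡ⇒id *ₚ-comm *ₚ-identityˡ
        ; distrib = comm∧distrʳ⇒distr +ₚ-cong *ₚ-comm *ₚ-distribʳ-+ₚ }
      ; *-comm = *ₚ-comm } }
    where open Consequences ≋-setoid

  private
    module ℙ = CommutativeRing ℙ
    module ℙ-Group = AbelianGroupProperties ℙ.+-abelianGroup
    module ℙ-Ring = RingProperties ℙ.ring

  open NaturalCoefficientSolver ℙ.commutativeSemiring using ()
    renaming (solve to solveₚ; _:=_ to _:=ₚ_; _:+_ to _:+ₚ_; _:*_ to _:*ₚ_; con to conₚ)

  -- The absolute value

  instance
    q-nonZero : NonZero q
    q-nonZero = nonZeroIndex 0#

  ∣c∷p∣≡q*∣p∣ : ∀ c p → 0 < ∣ p ∣ → ∣ c ∷ p ∣ ≡ q * ∣ p ∣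
  ∣c∷p∣≡q*∣p∣ c p 0<∣p∣ with ∣ p ∣
  ... | suc _ = refl

  ∣0∷p∣≡0 : ∀ c p → ∣ p ∣ ≡ 0 → c ≡ 0# → ∣ c ∷ p ∣ ≡ 0
  ∣0∷p∣≡0 c p ∣p∣≡0 c≡0 rewrite ∣p∣≡0 with c Fin.≟ 0#
  ... | yes _   = refl
  ... | no  c≢0 = ⊥-elim (c≢0 c≡0)

  ∣c∷p∣≡1 : ∀ c p → ∣ p ∣ ≡ 0 → c ≢ 0# → ∣ c ∷ p ∣ ≡ 1
  ∣c∷p∣≡1 c p ∣p∣≡0 c≢0 rewrite ∣p∣≡0 with c Fin.≟ 0#
  ... | yes c≡0 = ⊥-elim (c≢0 c≡0)
  ... | no  _   = refl

  ≋0⇒∣p∣≡0 : ∀ {p} → p ≋ [] → ∣ p ∣ ≡ 0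
  ≋0⇒∣p∣≡0 {[]}    _               = refl
  ≋0⇒∣p∣≡0 {c ∷ p} (coeffwise p≈0) =
    ∣0∷p∣≡0 c p (≋0⇒∣p∣≡0 {p} (coeffwise λ i → p≈0 (suc i))) (p≈0 zero)

  record HasLeadingTerm (p : Pol) (n : ℕ) (c : Fin q) : Set where
    constructor leadingTerm
    field
      coeff-n≡c   : coeff p n ≡ c
      c≢0         : c ≢ 0#
      coeff-above : ∀ i → n < i → coeff p i ≡ 0#

  HasLeadingTerm-tail : ∀ {e p n c} → HasLeadingTerm (e ∷ p) (suc n) c → HasLeadingTerm p n c
  HasLeadingTerm-tail (leadingTerm pₙ≡c c≢0 above) =
    leadingTerm pₙ≡c c≢0 λ i n<i → above (suc i) (s≤s n<i)

  HasLeadingTerm₀⇒tail≋0 : ∀ {e p c} → HasLeadingTerm (e ∷ p) 0 c → p ≋ []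
  HasLeadingTerm₀⇒tail≋0 (leadingTerm _ _ above) = coeffwise λ i → above (suc i) (s≤s z≤n)

  HasLeadingTerm⇒∣p∣≡q^n : ∀ {p n c} → HasLeadingTerm p n c → ∣ p ∣ ≡ q ^ n
  HasLeadingTerm⇒∣p∣≡q^n {[]}    (leadingTerm 0≡c c≢0 _) = ⊥-elim (c≢0 (sym 0≡c))
  HasLeadingTerm⇒∣p∣≡q^n {d ∷ p} {zero} lt@(leadingTerm d≡c c≢0 _) =
    ∣c∷p∣≡1 d p (≋0⇒∣p∣≡0 (HasLeadingTerm₀⇒tail≋0 lt)) (λ d≡0 → c≢0 (trans (sym d≡c) d≡0))
  HasLeadingTerm⇒∣p∣≡q^n {d ∷ p} {suc n} lt = begin
    ∣ d ∷ p ∣  ≡⟨ ∣c∷p∣≡q*∣p∣ d p (subst (0 <_) (sym ∣p∣≡q^n) (ℕ.m^n>0 q n)) ⟩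
    q * ∣ p ∣  ≡⟨ cong (q *_) ∣p∣≡q^n ⟩
    q ^ suc n  ∎
    where
    open ≡-Reasoning
    ∣p∣≡q^n : ∣ p ∣ ≡ q ^ n
    ∣p∣≡q^n = HasLeadingTerm⇒∣p∣≡q^n (HasLeadingTerm-tail lt)

  ≋0⊎HasLeadingTerm : ∀ p → p ≋ [] ⊎ ∃₂ (HasLeadingTerm p)
  ≋0⊎HasLeadingTerm []      = inj₁ ≋-refl
  ≋0⊎HasLeadingTerm (c ∷ p) with ≋0⊎HasLeadingTerm p
  ... | inj₂ (n , d , leadingTerm pₙ≡d d≢0 above) =
    inj₂ (suc n , d , leadingTerm pₙ≡d d≢0 λ { zero () ; (suc i) (s≤s n<i) → above i n<i })
  ... | inj₁ (coeffwise p≈0) with c Fin.≟ 0#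
  ...   | yes c≡0 = inj₁ (coeffwise λ { zero → c≡0 ; (suc i) → p≈0 i })
  ...   | no  c≢0 = inj₂ (0 , c , leadingTerm refl c≢0 λ { zero () ; (suc i) _ → p≈0 i })

  HasLeadingTerm-cong : ∀ {p r n c} → p ≋ r → HasLeadingTerm p n c → HasLeadingTerm r n c
  HasLeadingTerm-cong {n = n} (coeffwise p≈r) (leadingTerm pₙ≡c c≢0 above) =
    leadingTerm (trans (sym (p≈r n)) pₙ≡c) c≢0 λ i n<i → trans (sym (p≈r i)) (above i n<i)

  ∣∣-cong : ∀ {p r} → p ≋ r → ∣ p ∣ ≡ ∣ r ∣
  ∣∣-cong {p} p≋r with ≋0⊎HasLeadingTerm p
  ... | inj₁ p≋0 = trans (≋0⇒∣p∣≡0 p≋0) (sym (≋0⇒∣p∣≡0 (≋-trans (≋-sym p≋r) p≋0)))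
  ... | inj₂ (_ , _ , lt) =
    trans (HasLeadingTerm⇒∣p∣≡q^n lt) (sym (HasLeadingTerm⇒∣p∣≡q^n (HasLeadingTerm-cong p≋r lt)))

  ∣p∣≤q^n : ∀ p n → (∀ i → n < i → coeff p i ≡ 0#) → ∣ p ∣ ≤ q ^ n
  ∣p∣≤q^n p n above with ≋0⊎HasLeadingTerm p
  ... | inj₁ p≋0 rewrite ≋0⇒∣p∣≡0 p≋0 = z≤n
  ... | inj₂ (m , c , lt@(leadingTerm pₘ≡c c≢0 _)) rewrite HasLeadingTerm⇒∣p∣≡q^n lt with m ℕ.≤? n
  ...   | yes m≤n = ℕ.^-monoʳ-≤ q m≤n
  ...   | no  m≰n = ⊥-elim (c≢0 (trans (sym pₘ≡c) (above m (ℕ.≰⇒> m≰n))))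

  ∣p+r∣≤∣p∣⊔∣r∣ : ∀ p r → ∣ p +ₚ r ∣ ≤ ∣ p ∣ ⊔ ∣ r ∣
  ∣p+r∣≤∣p∣⊔∣r∣ p r with ≋0⊎HasLeadingTerm p | ≋0⊎HasLeadingTerm r
  ... | inj₁ p≋0 | _ =
    subst (_≤ ∣ p ∣ ⊔ ∣ r ∣) (sym (∣∣-cong (+ₚ-cong p≋0 ≋-refl))) (ℕ.m≤n⊔m ∣ p ∣ ∣ r ∣)
  ... | inj₂ _ | inj₁ r≋0 =
    subst (_≤ ∣ p ∣ ⊔ ∣ r ∣) (sym (∣∣-cong (≋-trans (+ₚ-cong ≋-refl r≋0) (+ₚ-identityʳ p))))
          (ℕ.m≤m⊔n ∣ p ∣ ∣ r ∣)
  ... | inj₂ (n , _ , ltp) | inj₂ (m , _ , ltr) = begin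
    ∣ p +ₚ r ∣         ≤⟨ ∣p∣≤q^n (p +ₚ r) (n ⊔ m) vanishes ⟩
    q ^ (n ⊔ m)        ≡⟨ ℕ.mono-≤-distrib-⊔ (ℕ.^-monoʳ-≤ q) n m ⟩
    q ^ n ⊔ q ^ m      ≡⟨ cong₂ _⊔_ (HasLeadingTerm⇒∣p∣≡q^n ltp) (HasLeadingTerm⇒∣p∣≡q^n ltr) ⟨
    ∣ p ∣ ⊔ ∣ r ∣      ∎
    where
    open ℕ.≤-Reasoning
    vanishes : ∀ i → n ⊔ m < i → coeff (p +ₚ r) i ≡ 0#
    vanishes i n⊔m<i = trans (coeff-+ₚ p r i)
      (trans (cong₂ _⊕_ (HasLeadingTerm.coeff-above ltp i (ℕ.≤-<-trans (ℕ.m≤m⊔n n m) n⊔m<i))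
                        (HasLeadingTerm.coeff-above ltr i (ℕ.≤-<-trans (ℕ.m≤n⊔m n m) n⊔m<i)))
             (F.+-identityˡ 0#))

  ⊗-≢0 : ∀ {c d} → c ≢ 0# → d ≢ 0# → c ⊗ d ≢ 0#
  ⊗-≢0 {c} {d} c≢0 d≢0 cd≡0 with inverse c c≢0
  ... | c⁻¹ , cc⁻¹≡1 = d≢0 (begin
    d              ≡⟨ F.*-identityˡ d ⟨
    1# ⊗ d         ≡⟨ cong (_⊗ d) cc⁻¹≡1 ⟨
    c ⊗ c⁻¹ ⊗ d    ≡⟨ solve 3 (λ c y d → c :* y :* d := y :* (c :* d)) refl c c⁻¹ d ⟩
    c⁻¹ ⊗ (c ⊗ d)  ≡⟨ cong (c⁻¹ ⊗_) cd≡0 ⟩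
    c⁻¹ ⊗ 0#       ≡⟨ F.zeroʳ c⁻¹ ⟩
    0#             ∎)
    where open ≡-Reasoning

  HasLeadingTerm-*ₚ : ∀ {p r n m c d} → HasLeadingTerm p n c → HasLeadingTerm r m d →
                      HasLeadingTerm (p *ₚ r) (n + m) (c ⊗ d)
  HasLeadingTerm-*ₚ {[]} (leadingTerm 0≡c c≢0 _) _ = ⊥-elim (c≢0 (sym 0≡c))
  HasLeadingTerm-*ₚ {e ∷ p} {r} {zero} {m} ltp@(leadingTerm e≡c c≢0 _) (leadingTerm rₘ≡d d≢0 r-above) =
    leadingTerm (trans (coeff≡e⊗ m) (cong₂ _⊗_ e≡c rₘ≡d)) (⊗-≢0 c≢0 d≢0)
                λ i m<i → trans (coeff≡e⊗ i) (trans (cong (e ⊗_) (r-above i m<i)) (F.zeroʳ e))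
    where
    open ≡-Reasoning
    0∷p*r≋0 : 0# ∷ p *ₚ r ≋ []
    0∷p*r≋0 = 0∷-≋0 (p≋0⇒p*r≋0 p r (HasLeadingTerm₀⇒tail≋0 ltp))
    coeff≡e⊗ : ∀ i → coeff ((e ∷ p) *ₚ r) i ≡ e ⊗ coeff r i
    coeff≡e⊗ i = begin
      coeff ((e ∷ p) *ₚ r) i                 ≡⟨ coeff-∷-*ₚ e p r i ⟩
      e ⊗ coeff r i ⊕ coeff (0# ∷ p *ₚ r) i  ≡⟨ cong (e ⊗ coeff r i ⊕_) (coeff≡ 0∷p*r≋0 i) ⟩
      e ⊗ coeff r i ⊕ 0#                     ≡⟨ F.+-identityʳ _ ⟩
      e ⊗ coeff r i                          ∎
  HasLeadingTerm-*ₚ {e ∷ p} {r} {suc n} {m} ltp@(leadingTerm _ c≢0 _) ltr@(leadingTerm _ d≢0 r-above) =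
    leadingTerm (trans (coeff≡tail (suc (n + m)) (s≤s (ℕ.m≤n+m m n))) pr-top) (⊗-≢0 c≢0 d≢0)
      λ { zero () ; (suc j) (s≤s n+m<j) →
          trans (coeff≡tail (suc j) (s≤s (ℕ.≤-trans (ℕ.m≤n+m m n) (ℕ.<⇒≤ n+m<j))))
                (pr-above j n+m<j) }
    where
    open HasLeadingTerm (HasLeadingTerm-*ₚ (HasLeadingTerm-tail ltp) ltr)
      using () renaming (coeff-n≡c to pr-top; coeff-above to pr-above)
    coeff≡tail : ∀ i → m < i → coeff ((e ∷ p) *ₚ r) i ≡ coeff (0# ∷ p *ₚ r) i
    coeff≡tail i m<i = trans (coeff-∷-*ₚ e p r i)
      (trans (cong (_⊕ coeff (0# ∷ p *ₚ r) i) (trans (cong (e ⊗_) (r-above i m<i)) (F.zeroʳ e)))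
             (F.+-identityˡ _))

  ∣p*r∣≡∣p∣*∣r∣ : ∀ p r → ∣ p *ₚ r ∣ ≡ ∣ p ∣ * ∣ r ∣
  ∣p*r∣≡∣p∣*∣r∣ p r with ≋0⊎HasLeadingTerm p | ≋0⊎HasLeadingTerm r
  ... | inj₁ p≋0 | _
    rewrite ≋0⇒∣p∣≡0 (p≋0⇒p*r≋0 p r p≋0) | ≋0⇒∣p∣≡0 p≋0 = refl
  ... | inj₂ _ | inj₁ r≋0
    rewrite ≋0⇒∣p∣≡0 (≋-trans (*ₚ-congˡ p r≋0) (*ₚ-zeroʳ p)) | ≋0⇒∣p∣≡0 r≋0 = sym (ℕ.*-zeroʳ ∣ p ∣)
  ... | inj₂ (n , _ , ltp) | inj₂ (m , _ , ltr)
    rewrite HasLeadingTerm⇒∣p∣≡q^n (HasLeadingTerm-*ₚ ltp ltr)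
          | HasLeadingTerm⇒∣p∣≡q^n ltp | HasLeadingTerm⇒∣p∣≡q^n ltr = ℕ.^-distribˡ-+-* q n m

  ∣-p∣≡∣p∣ : ∀ p → ∣ -ₚ p ∣ ≡ ∣ p ∣
  ∣-p∣≡∣p∣ p with ≋0⊎HasLeadingTerm p
  ... | inj₁ p≋0 = trans (≋0⇒∣p∣≡0 (-ₚ‿cong p≋0)) (sym (≋0⇒∣p∣≡0 p≋0))
  ... | inj₂ (n , c , ltp@(leadingTerm pₙ≡c c≢0 above)) =
    trans (HasLeadingTerm⇒∣p∣≡q^n { -ₚ p} (leadingTerm (trans (coeff--ₚ p n) (cong ⊖_ pₙ≡c)) -c≢0
             λ i n<i → trans (coeff--ₚ p i) (trans (cong ⊖_ (above i n<i)) F-Group.ε⁻¹≈ε)))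
          (sym (HasLeadingTerm⇒∣p∣≡q^n ltp))
    where
    -c≢0 : ⊖ c ≢ 0#
    -c≢0 -c≡0 = c≢0 (F-Group.⁻¹-injective (trans -c≡0 (sym F-Group.ε⁻¹≈ε)))

  ∣sgn∣≡∣p∣ : ∀ n p → ∣ sgn n p ∣ ≡ ∣ p ∣
  ∣sgn∣≡∣p∣ zero          p = refl
  ∣sgn∣≡∣p∣ (suc zero)    p = ∣-p∣≡∣p∣ p
  ∣sgn∣≡∣p∣ (suc (suc n)) p = ∣sgn∣≡∣p∣ n p

  ∣1∣≡1 : ∣ 1ₚ ∣ ≡ 1
  ∣1∣≡1 = ∣c∷p∣≡1 1# [] refl (λ 1≡0 → 0≢1 (sym 1≡0))

  ∣p∣≤∣p+r∣⊔∣r∣ : ∀ p r → ∣ p ∣ ≤ ∣ p +ₚ r ∣ ⊔ ∣ r ∣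
  ∣p∣≤∣p+r∣⊔∣r∣ p r = begin
    ∣ p ∣                   ≡⟨ ∣∣-cong (ℙ-Group.//-rightDividesʳ r p) ⟨
    ∣ p +ₚ r +ₚ -ₚ r ∣      ≤⟨ ∣p+r∣≤∣p∣⊔∣r∣ (p +ₚ r) (-ₚ r) ⟩
    ∣ p +ₚ r ∣ ⊔ ∣ -ₚ r ∣   ≡⟨ cong (∣ p +ₚ r ∣ ⊔_) (∣-p∣≡∣p∣ r) ⟩
    ∣ p +ₚ r ∣ ⊔ ∣ r ∣      ∎
    where open ℕ.≤-Reasoning

  ∣p∣∸∣r∣≤∣p+r∣ : ∀ p r → ∣ p ∣ ∸ ∣ r ∣ ≤ ∣ p +ₚ r ∣
  ∣p∣∸∣r∣≤∣p+r∣ p r = ℕ.m≤n+o⇒m∸n≤o ∣ p ∣ ∣ r ∣ (begin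
    ∣ p ∣                   ≤⟨ ∣p∣≤∣p+r∣⊔∣r∣ p r ⟩
    ∣ p +ₚ r ∣ ⊔ ∣ r ∣      ≤⟨ ℕ.m⊔n≤m+n ∣ p +ₚ r ∣ ∣ r ∣ ⟩
    ∣ p +ₚ r ∣ + ∣ r ∣      ≡⟨ ℕ.+-comm ∣ p +ₚ r ∣ ∣ r ∣ ⟩
    ∣ r ∣ + ∣ p +ₚ r ∣      ∎)
    where open ℕ.≤-Reasoning

  ∣r∣<∣p∣⇒∣p+r∣≡∣p∣ : ∀ p r → ∣ r ∣ < ∣ p ∣ → ∣ p +ₚ r ∣ ≡ ∣ p ∣
  ∣r∣<∣p∣⇒∣p+r∣≡∣p∣ p r ∣r∣<∣p∣ = ℕ.≤-antisym ∣p+r∣≤∣p∣ ∣p∣≤∣p+r∣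
    where
    ∣p+r∣≤∣p∣ : ∣ p +ₚ r ∣ ≤ ∣ p ∣
    ∣p+r∣≤∣p∣ = subst (∣ p +ₚ r ∣ ≤_) (ℕ.m≥n⇒m⊔n≡m (ℕ.<⇒≤ ∣r∣<∣p∣)) (∣p+r∣≤∣p∣⊔∣r∣ p r)
    ∣p∣≤∣p+r∣ : ∣ p ∣ ≤ ∣ p +ₚ r ∣
    ∣p∣≤∣p+r∣ with ℕ.⊔-sel ∣ p +ₚ r ∣ ∣ r ∣
    ... | inj₁ ⊔≡l = subst (∣ p ∣ ≤_) ⊔≡l (∣p∣≤∣p+r∣⊔∣r∣ p r)
    ... | inj₂ ⊔≡r = ⊥-elim (ℕ.<⇒≱ ∣r∣<∣p∣ (subst (∣ p ∣ ≤_) ⊔≡r (∣p∣≤∣p+r∣⊔∣r∣ p r)))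

  -- Convergents

  -- The last field is stated against Q_n because P_{-1} = 1 while Q_{-1} = 0.
  record ConvergentBounds (A : ℕ → Pol) (n : ℕ) : Set where
    field
      ∣Pₙ∣≤∣Qₙ∣   : ∣ P A n ∣ ≤ ∣ Q A n ∣
      ∣Qₙ₋₁∣<∣Qₙ∣ : ∣ Q₋₁ A n ∣ < ∣ Q A n ∣
      ∣Pₙ₋₁∣≤∣Qₙ∣ : ∣ P₋₁ A n ∣ ≤ ∣ Q A n ∣

  convergentBounds : ∀ A → IsCFExpansion A → ∀ n → ConvergentBounds A n
  convergentBounds A (∣A₀∣≤1 , _) zero = record
    { ∣Pₙ∣≤∣Qₙ∣   = subst₂ _≤_ (sym ∣P₀∣≡∣A₀∣) (sym ∣Q₀∣≡1) ∣A₀∣≤1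
    ; ∣Qₙ₋₁∣<∣Qₙ∣ = subst (0 <_) (sym ∣Q₀∣≡1) (s≤s z≤n)
    ; ∣Pₙ₋₁∣≤∣Qₙ∣ = subst₂ _≤_ (sym ∣1∣≡1) (sym ∣Q₀∣≡1) ℕ.≤-refl
    }
    where
    ∣Q₀∣≡1 : ∣ Q A 0 ∣ ≡ 1
    ∣Q₀∣≡1 = trans (∣∣-cong (+ₚ-cong (*ₚ-zeroʳ (A 0)) ≋-refl)) ∣1∣≡1
    ∣P₀∣≡∣A₀∣ : ∣ P A 0 ∣ ≡ ∣ A 0 ∣
    ∣P₀∣≡∣A₀∣ = ∣∣-cong (≋-trans (+ₚ-identityʳ (A 0 *ₚ 1ₚ)) (ℙ.*-identityʳ (A 0)))
  convergentBounds A isCF@(_ , 1<∣Aᵢ₊₁∣) (suc n) = record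
    { ∣Pₙ∣≤∣Qₙ∣   = ∣Pₙ₊₁∣≤∣Qₙ₊₁∣
    ; ∣Qₙ₋₁∣<∣Qₙ∣ = ∣Qₙ∣<∣Qₙ₊₁∣
    ; ∣Pₙ₋₁∣≤∣Qₙ∣ = ℕ.≤-trans ∣Pₙ∣≤∣Qₙ∣ (ℕ.<⇒≤ ∣Qₙ∣<∣Qₙ₊₁∣)
    }
    where
    open ConvergentBounds (convergentBounds A isCF n)
    a : ℕ
    a = ∣ A (suc n) ∣
    instance
      a-nonZero : NonZero a
      a-nonZero = >-nonZero (ℕ.<⇒≤ (1<∣Aᵢ₊₁∣ n))
      ∣Qₙ∣-nonZero : NonZero ∣ Q A n ∣
      ∣Qₙ∣-nonZero = >-nonZero (ℕ.≤-<-trans z≤n ∣Qₙ₋₁∣<∣Qₙ∣)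
    ∣Qₙ∣≤a*∣Qₙ∣ : ∣ Q A n ∣ ≤ a * ∣ Q A n ∣
    ∣Qₙ∣≤a*∣Qₙ∣ = ℕ.m≤n*m ∣ Q A n ∣ a
    ∣Qₙ∣<a*∣Qₙ∣ : ∣ Q A n ∣ < a * ∣ Q A n ∣
    ∣Qₙ∣<a*∣Qₙ∣ = subst (∣ Q A n ∣ <_) (ℕ.*-comm ∣ Q A n ∣ a) (ℕ.m<m*n ∣ Q A n ∣ a (1<∣Aᵢ₊₁∣ n))
    ∣Qₙ₊₁∣≡a*∣Qₙ∣ : ∣ Q A (suc n) ∣ ≡ a * ∣ Q A n ∣
    ∣Qₙ₊₁∣≡a*∣Qₙ∣ = trans
      (∣r∣<∣p∣⇒∣p+r∣≡∣p∣ (A (suc n) *ₚ Q A n) (Q₋₁ A n)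
        (subst (∣ Q₋₁ A n ∣ <_) (sym (∣p*r∣≡∣p∣*∣r∣ (A (suc n)) (Q A n)))
               (ℕ.<-≤-trans ∣Qₙ₋₁∣<∣Qₙ∣ ∣Qₙ∣≤a*∣Qₙ∣)))
      (∣p*r∣≡∣p∣*∣r∣ (A (suc n)) (Q A n))
    ∣Qₙ∣<∣Qₙ₊₁∣ : ∣ Q A n ∣ < ∣ Q A (suc n) ∣
    ∣Qₙ∣<∣Qₙ₊₁∣ = subst (∣ Q A n ∣ <_) (sym ∣Qₙ₊₁∣≡a*∣Qₙ∣) ∣Qₙ∣<a*∣Qₙ∣
    ∣Pₙ₊₁∣≤∣Qₙ₊₁∣ : ∣ P A (suc n) ∣ ≤ ∣ Q A (suc n) ∣
    ∣Pₙ₊₁∣≤∣Qₙ₊₁∣ = begin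
      ∣ A (suc n) *ₚ P A n +ₚ P₋₁ A n ∣
        ≤⟨ ∣p+r∣≤∣p∣⊔∣r∣ (A (suc n) *ₚ P A n) (P₋₁ A n) ⟩
      ∣ A (suc n) *ₚ P A n ∣ ⊔ ∣ P₋₁ A n ∣
        ≡⟨ cong (_⊔ ∣ P₋₁ A n ∣) (∣p*r∣≡∣p∣*∣r∣ (A (suc n)) (P A n)) ⟩
      a * ∣ P A n ∣ ⊔ ∣ P₋₁ A n ∣
        ≤⟨ ℕ.⊔-lub (ℕ.*-monoʳ-≤ a ∣Pₙ∣≤∣Qₙ∣) (ℕ.≤-trans ∣Pₙ₋₁∣≤∣Qₙ∣ ∣Qₙ∣≤a*∣Qₙ∣) ⟩
      a * ∣ Q A n ∣
        ≡⟨ ∣Qₙ₊₁∣≡a*∣Qₙ∣ ⟨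
      ∣ Q A (suc n) ∣
        ∎
      where open ℕ.≤-Reasoning

  -- 2×2 matrices

  infix 4 _≋ₘ_
  _≋ₘ_ : Mat2 → Mat2 → Set
  M ≋ₘ M' = (m11 M ≋ m11 M' × m12 M ≋ m12 M') × (m21 M ≋ m21 M' × m22 M ≋ m22 M')

  ∥∥-cong : ∀ {M M'} → M ≋ₘ M' → ∥ M ∥ ≡ ∥ M' ∥
  ∥∥-cong ((≋₁₁ , ≋₁₂) , (≋₂₁ , ≋₂₂)) =
    cong₂ _⊔_ (cong₂ _⊔_ (∣∣-cong ≋₁₁) (∣∣-cong ≋₁₂)) (cong₂ _⊔_ (∣∣-cong ≋₂₁) (∣∣-cong ≋₂₂))

  ·-assoc : ∀ L M N → L · M · N ≋ₘ L · (M · N)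
  ·-assoc (mat a b c d) (mat a' b' c' d') (mat a'' b'' c'' d'') =
    (entry a b a'' c'' , entry a b b'' d'') , (entry c d a'' c'' , entry c d b'' d'')
    where
    entry : ∀ x y u v →
      (x *ₚ a' +ₚ y *ₚ c') *ₚ u +ₚ (x *ₚ b' +ₚ y *ₚ d') *ₚ v ≋
      x *ₚ (a' *ₚ u +ₚ b' *ₚ v) +ₚ y *ₚ (c' *ₚ u +ₚ d' *ₚ v)
    entry = solveₚ 8 (λ a' b' c' d' x y u v →
        (x :*ₚ a' :+ₚ y :*ₚ c') :*ₚ u :+ₚ (x :*ₚ b' :+ₚ y :*ₚ d') :*ₚ v
      :=ₚ x :*ₚ (a' :*ₚ u :+ₚ b' :*ₚ v) :+ₚ y :*ₚ (c' :*ₚ u :+ₚ d' :*ₚ v)) ≋-refl a' b' c' d'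

  ∣m₁₁∣≤∥M∥ : ∀ M → ∣ m11 M ∣ ≤ ∥ M ∥
  ∣m₁₁∣≤∥M∥ (mat a b c d) = ℕ.≤-trans (ℕ.m≤m⊔n ∣ a ∣ ∣ b ∣) (ℕ.m≤m⊔n _ (∣ c ∣ ⊔ ∣ d ∣))

  ∣m₁₂∣≤∥M∥ : ∀ M → ∣ m12 M ∣ ≤ ∥ M ∥
  ∣m₁₂∣≤∥M∥ (mat a b c d) = ℕ.≤-trans (ℕ.m≤n⊔m ∣ a ∣ ∣ b ∣) (ℕ.m≤m⊔n _ (∣ c ∣ ⊔ ∣ d ∣))

  ∣m₂₁∣≤∥M∥ : ∀ M → ∣ m21 M ∣ ≤ ∥ M ∥
  ∣m₂₁∣≤∥M∥ (mat a b c d) = ℕ.≤-trans (ℕ.m≤m⊔n ∣ c ∣ ∣ d ∣) (ℕ.m≤n⊔m (∣ a ∣ ⊔ ∣ b ∣) _)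

  ∣m₂₂∣≤∥M∥ : ∀ M → ∣ m22 M ∣ ≤ ∥ M ∥
  ∣m₂₂∣≤∥M∥ (mat a b c d) = ℕ.≤-trans (ℕ.m≤n⊔m ∣ c ∣ ∣ d ∣) (ℕ.m≤n⊔m (∣ a ∣ ⊔ ∣ b ∣) _)

  ∣x*u+y*v∣≤m*n : ∀ {m n} x y u v → ∣ x ∣ ≤ m → ∣ y ∣ ≤ m → ∣ u ∣ ≤ n → ∣ v ∣ ≤ n →
                  ∣ x *ₚ u +ₚ y *ₚ v ∣ ≤ m * n
  ∣x*u+y*v∣≤m*n {m} {n} x y u v ∣x∣≤m ∣y∣≤m ∣u∣≤n ∣v∣≤n = begin
    ∣ x *ₚ u +ₚ y *ₚ v ∣             ≤⟨ ∣p+r∣≤∣p∣⊔∣r∣ (x *ₚ u) (y *ₚ v) ⟩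
    ∣ x *ₚ u ∣ ⊔ ∣ y *ₚ v ∣          ≡⟨ cong₂ _⊔_ (∣p*r∣≡∣p∣*∣r∣ x u) (∣p*r∣≡∣p∣*∣r∣ y v) ⟩
    ∣ x ∣ * ∣ u ∣ ⊔ ∣ y ∣ * ∣ v ∣    ≤⟨ ℕ.⊔-lub (ℕ.*-mono-≤ ∣x∣≤m ∣u∣≤n) (ℕ.*-mono-≤ ∣y∣≤m ∣v∣≤n) ⟩
    m * n                            ∎
    where open ℕ.≤-Reasoning

  ∥L·M∥≤∥L∥*∥M∥ : ∀ L M → ∥ L · M ∥ ≤ ∥ L ∥ * ∥ M ∥
  ∥L·M∥≤∥L∥*∥M∥ L@(mat a b c d) M@(mat a' b' c' d') =
    ℕ.⊔-lub (ℕ.⊔-lub (row₁ a' c' (∣m₁₁∣≤∥M∥ M) (∣m₂₁∣≤∥M∥ M))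
                     (row₁ b' d' (∣m₁₂∣≤∥M∥ M) (∣m₂₂∣≤∥M∥ M)))
            (ℕ.⊔-lub (row₂ a' c' (∣m₁₁∣≤∥M∥ M) (∣m₂₁∣≤∥M∥ M))
                     (row₂ b' d' (∣m₁₂∣≤∥M∥ M) (∣m₂₂∣≤∥M∥ M)))
    where
    row₁ : ∀ u v → ∣ u ∣ ≤ ∥ M ∥ → ∣ v ∣ ≤ ∥ M ∥ → ∣ a *ₚ u +ₚ b *ₚ v ∣ ≤ ∥ L ∥ * ∥ M ∥
    row₁ u v = ∣x*u+y*v∣≤m*n a b u v (∣m₁₁∣≤∥M∥ L) (∣m₁₂∣≤∥M∥ L)
    row₂ : ∀ u v → ∣ u ∣ ≤ ∥ M ∥ → ∣ v ∣ ≤ ∥ M ∥ → ∣ c *ₚ u +ₚ d *ₚ v ∣ ≤ ∥ L ∥ * ∥ M ∥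
    row₂ u v = ∣x*u+y*v∣≤m*n c d u v (∣m₂₁∣≤∥M∥ L) (∣m₂₂∣≤∥M∥ L)

  ∥U·M∥≤B : ∀ a Z Z' W W' {B} → ∣ Z ∣ ≤ B → ∣ Z' ∣ ≤ B → ∣ a *ₚ W ∣ ≤ B → ∣ a *ₚ W' ∣ ≤ B →
           ∣ W ∣ ≤ B → ∣ W' ∣ ≤ B → ∥ U a · mat Z Z' W W' ∥ ≤ B
  ∥U·M∥≤B a Z Z' W W' {B} ∣Z∣≤B ∣Z'∣≤B ∣aW∣≤B ∣aW'∣≤B ∣W∣≤B ∣W'∣≤B =
    ℕ.⊔-lub (ℕ.⊔-lub (top Z W ∣Z∣≤B ∣aW∣≤B) (top Z' W' ∣Z'∣≤B ∣aW'∣≤B))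
            (ℕ.⊔-lub (bottom W ∣W∣≤B) (bottom W' ∣W'∣≤B))
    where
    ∣1*p∣≡∣p∣ : ∀ p → ∣ 1ₚ *ₚ p ∣ ≡ ∣ p ∣
    ∣1*p∣≡∣p∣ p = ∣∣-cong (*ₚ-identityˡ p)
    top : ∀ Z W → ∣ Z ∣ ≤ B → ∣ a *ₚ W ∣ ≤ B → ∣ 1ₚ *ₚ Z +ₚ a *ₚ W ∣ ≤ B
    top Z W ∣Z∣≤B ∣aW∣≤B = ℕ.≤-trans (∣p+r∣≤∣p∣⊔∣r∣ (1ₚ *ₚ Z) (a *ₚ W))
      (ℕ.⊔-lub (subst (_≤ B) (sym (∣1*p∣≡∣p∣ Z)) ∣Z∣≤B) ∣aW∣≤B)
    bottom : ∀ W → ∣ W ∣ ≤ B → ∣ 0ₚ *ₚ Z +ₚ 1ₚ *ₚ W ∣ ≤ B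
    bottom W = subst (_≤ B) (sym (∣1*p∣≡∣p∣ W))

  ∥N·U·M∥≤∥N∥*∥U·M∥ : ∀ N a M → ∥ N · U a · M ∥ ≤ ∥ N ∥ * ∥ U a · M ∥
  ∥N·U·M∥≤∥N∥*∥U·M∥ N a M =
    subst (_≤ ∥ N ∥ * ∥ U a · M ∥) (sym (∥∥-cong (·-assoc N (U a) M))) (∥L·M∥≤∥L∥*∥M∥ N (U a · M))

  ∥U·Mₖ∥≤∣Qₖ∣⊔∣a*Qₖ₋₁∣ : ∀ A → IsCFExpansion A → ∀ k a → 1 ≤ k →
                          ∥ U a · M A k ∥ ≤ ∣ Q A k ∣ ⊔ ∣ a *ₚ Q₋₁ A k ∣
  ∥U·Mₖ∥≤∣Qₖ∣⊔∣a*Qₖ₋₁∣ A isCF (suc m) a _ =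
    ∥U·M∥≤B a (Q A k) (-ₚ P A k) (sgn m (Q A m)) (sgn k (P A m))
      ∣Qₖ∣≤B
      (subst (_≤ B) (sym (∣-p∣≡∣p∣ (P A k))) (ℕ.≤-trans ∣Pₖ∣≤∣Qₖ∣ ∣Qₖ∣≤B))
      (subst (_≤ B) (sym (∣a*sgn∣≡∣a*p∣ m (Q A m))) ∣aQₘ∣≤B)
      (subst (_≤ B) (sym (∣a*sgn∣≡∣a*p∣ k (P A m))) (ℕ.≤-trans ∣aPₘ∣≤∣aQₘ∣ ∣aQₘ∣≤B))
      (subst (_≤ B) (sym (∣sgn∣≡∣p∣ m (Q A m))) (ℕ.≤-trans (ℕ.<⇒≤ ∣Qₘ∣<∣Qₖ∣) ∣Qₖ∣≤B))
      (subst (_≤ B) (sym (∣sgn∣≡∣p∣ k (P A m))) (ℕ.≤-trans ∣Pₘ∣≤∣Qₖ∣ ∣Qₖ∣≤B))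
    where
    k : ℕ
    k = suc m
    B : ℕ
    B = ∣ Q A k ∣ ⊔ ∣ a *ₚ Q A m ∣
    open ConvergentBounds (convergentBounds A isCF k) using ()
      renaming (∣Pₙ∣≤∣Qₙ∣ to ∣Pₖ∣≤∣Qₖ∣; ∣Qₙ₋₁∣<∣Qₙ∣ to ∣Qₘ∣<∣Qₖ∣; ∣Pₙ₋₁∣≤∣Qₙ∣ to ∣Pₘ∣≤∣Qₖ∣)
    ∣Qₖ∣≤B : ∣ Q A k ∣ ≤ B
    ∣Qₖ∣≤B = ℕ.m≤m⊔n _ _
    ∣aQₘ∣≤B : ∣ a *ₚ Q A m ∣ ≤ B
    ∣aQₘ∣≤B = ℕ.m≤n⊔m _ _
    ∣aPₘ∣≤∣aQₘ∣ : ∣ a *ₚ P A m ∣ ≤ ∣ a *ₚ Q A m ∣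
    ∣aPₘ∣≤∣aQₘ∣ = subst₂ _≤_ (sym (∣p*r∣≡∣p∣*∣r∣ a (P A m))) (sym (∣p*r∣≡∣p∣*∣r∣ a (Q A m)))
      (ℕ.*-monoʳ-≤ ∣ a ∣ (ConvergentBounds.∣Pₙ∣≤∣Qₙ∣ (convergentBounds A isCF m)))
    ∣a*sgn∣≡∣a*p∣ : ∀ n p → ∣ a *ₚ sgn n p ∣ ≡ ∣ a *ₚ p ∣
    ∣a*sgn∣≡∣a*p∣ n p = trans (∣p*r∣≡∣p∣*∣r∣ a (sgn n p))
      (trans (cong (∣ a ∣ *_) (∣sgn∣≡∣p∣ n p)) (sym (∣p*r∣≡∣p∣*∣r∣ a p)))

  sgn≡id⊎sgn≡-ₚ : ∀ n → (∀ p → sgn n p ≡ p) ⊎ (∀ p → sgn n p ≡ -ₚ p)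
  sgn≡id⊎sgn≡-ₚ zero          = inj₁ λ _ → refl
  sgn≡id⊎sgn≡-ₚ (suc zero)    = inj₂ λ _ → refl
  sgn≡id⊎sgn≡-ₚ (suc (suc n)) = sgn≡id⊎sgn≡-ₚ n

  ∣[a*W+Z]*s∣∸∣s'*W∣≤∥N·U·M∥ : ∀ a t t' s s' Z Z' W W' →
    ∣ (a *ₚ W +ₚ Z) *ₚ s ∣ ∸ ∣ s' *ₚ W ∣ ≤ ∥ mat t t' s s' · U a · mat Z Z' W W' ∥
  ∣[a*W+Z]*s∣∸∣s'*W∣≤∥N·U·M∥ a t t' s s' Z Z' W W' = begin
    ∣ (a *ₚ W +ₚ Z) *ₚ s ∣ ∸ ∣ s' *ₚ W ∣   ≤⟨ ∣p∣∸∣r∣≤∣p+r∣ ((a *ₚ W +ₚ Z) *ₚ s) (s' *ₚ W) ⟩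
    ∣ (a *ₚ W +ₚ Z) *ₚ s +ₚ s' *ₚ W ∣      ≡⟨ ∣∣-cong γ₂₁-≋ ⟩
    ∣ m21 (N · U a · mat Z Z' W W') ∣      ≤⟨ ∣m₂₁∣≤∥M∥ (N · U a · mat Z Z' W W') ⟩
    ∥ N · U a · mat Z Z' W W' ∥            ∎
    where
    open ℕ.≤-Reasoning
    N : Mat2
    N = mat t t' s s'
    γ₂₁-≋ : (a *ₚ W +ₚ Z) *ₚ s +ₚ s' *ₚ W ≋ (s *ₚ 1ₚ +ₚ s' *ₚ 0ₚ) *ₚ Z +ₚ (s *ₚ a +ₚ s' *ₚ 1ₚ) *ₚ W
    γ₂₁-≋ = solveₚ 5 (λ a s s' Z W →
        (a :*ₚ W :+ₚ Z) :*ₚ s :+ₚ s' :*ₚ W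
      :=ₚ (s :*ₚ conₚ 1 :+ₚ s' :*ₚ conₚ 0) :*ₚ Z :+ₚ (s :*ₚ a :+ₚ s' :*ₚ conₚ 1) :*ₚ W)
      ≋-refl a s s' Z W

  ∣[a*R+±K]*s∣∸∣s'*R∣≤∥N·U·M∥ : ∀ n a t t' s s' K Z' R W' →
    ∣ (a *ₚ R +ₚ sgn n K) *ₚ s ∣ ∸ ∣ s' *ₚ R ∣ ≤ ∥ mat t t' s s' · U a · mat K Z' (sgn n R) W' ∥
  ∣[a*R+±K]*s∣∸∣s'*R∣≤∥N·U·M∥ n a t t' s s' K Z' R W' with sgn≡id⊎sgn≡-ₚ n
  ... | inj₁ sgn≡id rewrite sgn≡id K | sgn≡id R = ∣[a*W+Z]*s∣∸∣s'*W∣≤∥N·U·M∥ a t t' s s' K Z' R W'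
  ... | inj₂ sgn≡- rewrite sgn≡- K | sgn≡- R =
    subst₂ (λ x y → x ∸ y ≤ ∥ mat t t' s s' · U a · mat K Z' (-ₚ R) W' ∥) ∣X∣≡ ∣s'R∣≡
      (∣[a*W+Z]*s∣∸∣s'*W∣≤∥N·U·M∥ a t t' s s' K Z' (-ₚ R) W')
    where
    a*[-R]+K≋-[a*R-K] : a *ₚ (-ₚ R) +ₚ K ≋ -ₚ (a *ₚ R +ₚ (-ₚ K))
    a*[-R]+K≋-[a*R-K] = begin
      a *ₚ (-ₚ R) +ₚ K                ≈⟨ +ₚ-cong (ℙ-Ring.-‿distribʳ-* a R) (ℙ-Group.⁻¹-involutive K) ⟨
      -ₚ (a *ₚ R) +ₚ (-ₚ (-ₚ K))      ≈⟨ ℙ-Group.⁻¹-∙-comm (a *ₚ R) (-ₚ K) ⟩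
      -ₚ (a *ₚ R +ₚ (-ₚ K))           ∎
      where open ≋-Reasoning
    ∣X∣≡ : ∣ (a *ₚ (-ₚ R) +ₚ K) *ₚ s ∣ ≡ ∣ (a *ₚ R +ₚ (-ₚ K)) *ₚ s ∣
    ∣X∣≡ = begin
      ∣ (a *ₚ (-ₚ R) +ₚ K) *ₚ s ∣        ≡⟨ ∣p*r∣≡∣p∣*∣r∣ (a *ₚ (-ₚ R) +ₚ K) s ⟩
      ∣ a *ₚ (-ₚ R) +ₚ K ∣ * ∣ s ∣        ≡⟨ cong (_* ∣ s ∣) (∣∣-cong a*[-R]+K≋-[a*R-K]) ⟩
      ∣ -ₚ (a *ₚ R +ₚ (-ₚ K)) ∣ * ∣ s ∣   ≡⟨ cong (_* ∣ s ∣) (∣-p∣≡∣p∣ (a *ₚ R +ₚ (-ₚ K))) ⟩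
      ∣ a *ₚ R +ₚ (-ₚ K) ∣ * ∣ s ∣        ≡⟨ ∣p*r∣≡∣p∣*∣r∣ (a *ₚ R +ₚ (-ₚ K)) s ⟨
      ∣ (a *ₚ R +ₚ (-ₚ K)) *ₚ s ∣        ∎
      where open ≡-Reasoning
    ∣s'R∣≡ : ∣ s' *ₚ (-ₚ R) ∣ ≡ ∣ s' *ₚ R ∣
    ∣s'R∣≡ = trans (∣p*r∣≡∣p∣*∣r∣ s' (-ₚ R))
      (trans (cong (∣ s' ∣ *_) (∣-p∣≡∣p∣ R)) (sym (∣p*r∣≡∣p∣*∣r∣ s' R)))

lemma4p3 : ∀ {q} (𝔽 : FiniteField q) → let open Poly 𝔽 in
    (A : ℕ → Pol) → IsCFExpansion A →
    (k : ℕ) → 1 ≤ k → (a : Pol) → (t t' s s' : Pol) → InSL2 (mat t t' s s') →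
    let N = mat t t' s s'
        γ = N · U a · M A k
    in (∣ (a *ₚ Q₋₁ A k +ₚ sgn (k ∸ 1) (Q A k)) *ₚ s ∣ ∸ ∣ s' *ₚ Q₋₁ A k ∣ ≤ ∥ γ ∥)
       × (∥ γ ∥ ≤ ∥ N ∥ * (∣ Q A k ∣ ⊔ ∣ a *ₚ Q₋₁ A k ∣))
-- Neither bound uses det N = 1.
lemma4p3 𝔽 A isCF k@(suc m) 1≤k a t t' s s' _ =
  ∣[a*R+±K]*s∣∸∣s'*R∣≤∥N·U·M∥ 𝔽 m a t t' s s' (Q A k) (-ₚ P A k) (Q A m) (sgn k (P A m)) ,
  ℕ.≤-trans (∥N·U·M∥≤∥N∥*∥U·M∥ 𝔽 N a (M A k))
            (ℕ.*-monoʳ-≤ ∥ N ∥ (∥U·Mₖ∥≤∣Qₖ∣⊔∣a*Qₖ₋₁∣ 𝔽 A isCF k a 1≤k))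
  where
  open Poly 𝔽
  N : Mat2
  N = mat t t' s s'
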